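{- Let $k\ge 2$ and $n$ be integers with $n>k^3$. Let $H$ be a $(k-1)$-uniform hypergraph on $n-1$ vertices whose matching number is at most $n/k$. Then at least $\frac{1}{k+1}\binom{n-1}{k-1}$ of the $(k-1)$-element subsets of the vertex set are not edges of $H$.
   Context: The matching number of a hypergraph is the maximum number of pairwise disjoint edges. -}

module Defs where

open import Data.Nat using (ℕ; zero; suc; _≡ᵇ_; _*_; _≤_)
open import Data.Product using (_×_)
open import Data.Bool using (Bool; true; false; _∧_; not; T)
open import Data.Vec using ([]; _∷_)
open import Data.List using (List; []; _∷_; _++_; map; filterᵇ; length)
open import Data.List.Relation.Unary.All using (All)
open import Data.List.Relation.Unary.AllPairs using (AllPairs)
open import Data.Fin.Subset using (Subset; ∣_∣; _∩_; Empty)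
open import Relation.Binary.PropositionalEquality using (_≡_)

allSubsets : (m : ℕ) → List (Subset m)
allSubsets zero = [] ∷ []
allSubsets (suc m) = map (false ∷_) (allSubsets m) ++ map (true ∷_) (allSubsets m)

record UniformHypergraph (r m : ℕ) : Set where
  field
    isEdge  : Subset m → Bool
    uniform : ∀ (e : Subset m) → T (isEdge e) → ∣ e ∣ ≡ r
open UniformHypergraph public

Disjoint : ∀ {m} → Subset m → Subset m → Set
Disjoint p q = Empty (p ∩ q)

IsMatching : ∀ {r m} → UniformHypergraph r m → List (Subset m) → Set
IsMatching H M = All (λ e → T (isEdge H e)) M × AllPairs Disjoint M

-- "matching number ≤ n / k": every matching M satisfies |M| ≤ n/k, i.e. k·|M| ≤ n.
MatchingNumberAtMost : ∀ {r m} → UniformHypergraph r m → (n k : ℕ) → Set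
MatchingNumberAtMost H n k = ∀ M → IsMatching H M → k * length M ≤ n

nonEdgeCount : ∀ {r m} → UniformHypergraph r m → ℕ
nonEdgeCount {r} {m} H =
  length (filterᵇ (λ s → (∣ s ∣ ≡ᵇ r) ∧ not (isEdge H s)) (allSubsets m))

module Submission where

-- Write r = k − 1 and N = n − 1; for U ⊆ Fin N let edgesIn U and nonEdgesIn U
-- count the r-subsets of U that are / are not edges of H, so together they
-- number C(∣ U ∣, r).  The heart of the proof is an averaging inequality:
-- if r·t ≤ ∣ U ∣ and every matching inside U has at most s edges, then
--     t · edgesIn U ≤ s · C(∣ U ∣, r)
-- (cut U into t random disjoint r-sets: at most s of them are edges).  It is
-- proved by induction on t: remove an r-subset e ⊆ U, apply the hypothesis to
-- U ∖ e, and sum over all e, double counting the r-subsets of U ∖ e.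
-- For U = Fin N, t = ⌊N/r⌋ and s = ⌊n/k⌋, the assumption n > k³ yields
-- (k + 1)·s ≤ k·t, which turns the inequality into C(N, r) ≤ (k + 1)·nonEdges.

open import Defs
open import Data.Nat using (ℕ; zero; suc; _+_; _*_; _^_; _∸_; _≤_; _<_; _≡ᵇ_; z≤n; s≤s; NonZero; >-nonZero; >-nonZero⁻¹)
open import Data.Nat.Properties
open import Data.Nat.Combinatorics using (_C_; nCk+nC[k+1]≡[n+1]C[k+1])
open import Data.Nat.DivMod using (_/_; _%_; m≡m%n+[m/n]*n; m%n<n; m/n*n≤m; m*n/n≡m; /-monoˡ-≤; m≥n⇒m/n>0)
open import Data.Nat.Solver using (module +-*-Solver)
open import Data.Bool using (Bool; true; false; _∧_; not; T; if_then_else_)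
open import Data.Bool.Properties using (∧-zeroʳ; ∧-identityʳ; ∧-assoc; T-∧)
open import Function.Bundles using (Equivalence)
open import Data.Vec using ([]; _∷_; there)
open import Data.List using (List; []; _∷_; _++_; map; filterᵇ; length)
open import Data.List.Relation.Unary.All as All using (All; []; _∷_)
open import Data.List.Relation.Unary.AllPairs using ([]; _∷_)
open import Data.Fin using (zero; suc)
open import Data.Fin.Subset using (Subset; ∣_∣; _─_; ⊤)
open import Data.Fin.Subset.Properties using (∣⊤∣≡n)
open import Data.Product using (_×_; _,_; proj₁; proj₂)
open import Data.Unit using (tt)
open import Relation.Binary.PropositionalEquality
open import Algebra.Properties.CommutativeSemigroup +-commutativeSemigroup
  using () renaming (interchange to +-interchange; x∙yz≈y∙xz to +-left-exchange)

module _ {A : Set} where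

  sumWhere : List A → (A → Bool) → (A → ℕ) → ℕ
  sumWhere []       P g = 0
  sumWhere (x ∷ xs) P g = (if P x then g x else 0) + sumWhere xs P g

  sumWhere-cong : ∀ xs P {g h} → (∀ x → T (P x) → g x ≡ h x) →
                  sumWhere xs P g ≡ sumWhere xs P h
  sumWhere-cong []       P eq = refl
  sumWhere-cong (x ∷ xs) P eq with P x in Px
  ... | true  = cong₂ _+_ (eq x (subst T (sym Px) tt)) (sumWhere-cong xs P eq)
  ... | false = sumWhere-cong xs P eq

  sumWhere-congᶠ : ∀ xs {P Q} g → (∀ x → P x ≡ Q x) →
                   sumWhere xs P g ≡ sumWhere xs Q g
  sumWhere-congᶠ []       g eq = refl
  sumWhere-congᶠ (x ∷ xs) g eq rewrite eq x = cong (_ +_) (sumWhere-congᶠ xs g eq)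

  sumWhere-mono : ∀ xs P {g h} → (∀ x → T (P x) → g x ≤ h x) →
                  sumWhere xs P g ≤ sumWhere xs P h
  sumWhere-mono []       P le = z≤n
  sumWhere-mono (x ∷ xs) P le with P x in Px
  ... | true  = +-mono-≤ (le x (subst T (sym Px) tt)) (sumWhere-mono xs P le)
  ... | false = sumWhere-mono xs P le

  sumWhere-++ : ∀ xs ys P g → sumWhere (xs ++ ys) P g ≡ sumWhere xs P g + sumWhere ys P g
  sumWhere-++ []       ys P g = refl
  sumWhere-++ (x ∷ xs) ys P g =
    trans (cong (_ +_) (sumWhere-++ xs ys P g)) (sym (+-assoc (if P x then g x else 0) (sumWhere xs P g) (sumWhere ys P g)))

  sumWhere-zero : ∀ xs P → sumWhere xs P (λ _ → 0) ≡ 0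
  sumWhere-zero []       P = refl
  sumWhere-zero (x ∷ xs) P with P x
  ... | true  = sumWhere-zero xs P
  ... | false = sumWhere-zero xs P

  sumWhere-none : ∀ xs P g → (∀ x → P x ≡ false) → sumWhere xs P g ≡ 0
  sumWhere-none []       P g none = refl
  sumWhere-none (x ∷ xs) P g none rewrite none x = sumWhere-none xs P g none

  sumWhere-+ : ∀ xs P g h →
               sumWhere xs P (λ x → g x + h x) ≡ sumWhere xs P g + sumWhere xs P h
  sumWhere-+ []       P g h = refl
  sumWhere-+ (x ∷ xs) P g h with P x
  ... | true  = trans (cong (g x + h x +_) (sumWhere-+ xs P g h)) (+-interchange (g x) (h x) _ _)
  ... | false = sumWhere-+ xs P g h

  sumWhere-*ˡ : ∀ xs P c g → sumWhere xs P (λ x → c * g x) ≡ c * sumWhere xs P g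
  sumWhere-*ˡ []       P c g = sym (*-zeroʳ c)
  sumWhere-*ˡ (x ∷ xs) P c g with P x
  ... | true  = trans (cong (c * g x +_) (sumWhere-*ˡ xs P c g)) (sym (*-distribˡ-+ c (g x) _))
  ... | false = sumWhere-*ˡ xs P c g

  sumWhere-const : ∀ xs P c → sumWhere xs P (λ _ → c) ≡ c * sumWhere xs P (λ _ → 1)
  sumWhere-const xs P c =
    trans (sumWhere-cong xs P (λ _ _ → sym (*-identityʳ c))) (sumWhere-*ˡ xs P c (λ _ → 1))

  sumWhere-∧ : ∀ xs (P Q : A → Bool) g →
               sumWhere xs (λ x → P x ∧ Q x) g ≡ sumWhere xs P (λ x → if Q x then g x else 0)
  sumWhere-∧ []       P Q g = refl
  sumWhere-∧ (x ∷ xs) P Q g with P x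
  ... | true  = cong (_ +_) (sumWhere-∧ xs P Q g)
  ... | false = sumWhere-∧ xs P Q g

  sumWhere-split : ∀ xs (P Q : A → Bool) g →
    sumWhere xs P g ≡ sumWhere xs (λ x → P x ∧ Q x) g + sumWhere xs (λ x → P x ∧ not (Q x)) g
  sumWhere-split []       P Q g = refl
  sumWhere-split (x ∷ xs) P Q g rewrite sumWhere-split xs P Q g with P x | Q x
  ... | true  | true  = sym (+-assoc (g x) _ _)
  ... | true  | false =
    +-left-exchange (g x) (sumWhere xs (λ y → P y ∧ Q y) g) (sumWhere xs (λ y → P y ∧ not (Q y)) g)
  ... | false | _     = refl

  sumWhere-swap : ∀ xs ys P Q (D : A → A → ℕ) →
    sumWhere xs P (λ x → sumWhere ys Q (D x)) ≡ sumWhere ys Q (λ y → sumWhere xs P (λ x → D x y))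
  sumWhere-swap []       ys P Q D = sym (sumWhere-zero ys Q)
  sumWhere-swap (x ∷ xs) ys P Q D =
    trans (cong₂ _+_ (row (P x)) (sumWhere-swap xs ys P Q D))
          (sym (sumWhere-+ ys Q (λ y → if P x then D x y else 0) (λ y → sumWhere xs P (λ z → D z y))))
    where
    row : ∀ b → (if b then sumWhere ys Q (D x) else 0) ≡ sumWhere ys Q (λ y → if b then D x y else 0)
    row true  = refl
    row false = sym (sumWhere-zero ys Q)

  length-filterᵇ : ∀ xs P → length (filterᵇ P xs) ≡ sumWhere xs P (λ _ → 1)
  length-filterᵇ []       P = refl
  length-filterᵇ (x ∷ xs) P with P x
  ... | true  = cong suc (length-filterᵇ xs P)
  ... | false = length-filterᵇ xs P

sumWhere-map : ∀ {A B : Set} (f : A → B) xs P g →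
               sumWhere (map f xs) P g ≡ sumWhere xs (λ x → P (f x)) (λ x → g (f x))
sumWhere-map f []       P g = refl
sumWhere-map f (x ∷ xs) P g = cong (_ +_) (sumWhere-map f xs P g)

_⊆ᵇ_ : ∀ {m} → Subset m → Subset m → Bool
[]          ⊆ᵇ []      = true
(false ∷ p) ⊆ᵇ (_ ∷ q) = p ⊆ᵇ q
(true  ∷ p) ⊆ᵇ (y ∷ q) = y ∧ (p ⊆ᵇ q)

disjointᵇ : ∀ {m} → Subset m → Subset m → Bool
disjointᵇ []          []          = true
disjointᵇ (true  ∷ p) (true  ∷ q) = false
disjointᵇ (true  ∷ p) (false ∷ q) = disjointᵇ p q
disjointᵇ (false ∷ p) (_     ∷ q) = disjointᵇ p q

disjointᵇ-comm : ∀ {m} (p q : Subset m) → disjointᵇ p q ≡ disjointᵇ q p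
disjointᵇ-comm []          []          = refl
disjointᵇ-comm (true  ∷ p) (true  ∷ q) = refl
disjointᵇ-comm (true  ∷ p) (false ∷ q) = disjointᵇ-comm p q
disjointᵇ-comm (false ∷ p) (true  ∷ q) = disjointᵇ-comm p q
disjointᵇ-comm (false ∷ p) (false ∷ q) = disjointᵇ-comm p q

disjointᵇ⇒Disjoint : ∀ {m} (p q : Subset m) → T (disjointᵇ p q) → Disjoint p q
disjointᵇ⇒Disjoint (true  ∷ p) (false ∷ q) h (zero  , ())
disjointᵇ⇒Disjoint (true  ∷ p) (false ∷ q) h (suc i , there i∈) = disjointᵇ⇒Disjoint p q h (i , i∈)
disjointᵇ⇒Disjoint (false ∷ p) (true  ∷ q) h (zero  , ())
disjointᵇ⇒Disjoint (false ∷ p) (true  ∷ q) h (suc i , there i∈) = disjointᵇ⇒Disjoint p q h (i , i∈)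
disjointᵇ⇒Disjoint (false ∷ p) (false ∷ q) h (zero  , ())
disjointᵇ⇒Disjoint (false ∷ p) (false ∷ q) h (suc i , there i∈) = disjointᵇ⇒Disjoint p q h (i , i∈)

⊆ᵇ-─ : ∀ {m} (f U e : Subset m) → f ⊆ᵇ (U ─ e) ≡ (f ⊆ᵇ U) ∧ disjointᵇ f e
⊆ᵇ-─ []          []      []          = refl
⊆ᵇ-─ (false ∷ f) (u ∷ U) (x     ∷ e) = ⊆ᵇ-─ f U e
⊆ᵇ-─ (true  ∷ f) (u ∷ U) (true  ∷ e) = sym (∧-zeroʳ (u ∧ (f ⊆ᵇ U)))
⊆ᵇ-─ (true  ∷ f) (u ∷ U) (false ∷ e) =
  trans (cong (u ∧_) (⊆ᵇ-─ f U e)) (sym (∧-assoc u (f ⊆ᵇ U) (disjointᵇ f e)))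

∣─∣+∣∣≡∣∣ : ∀ {m} (U e : Subset m) → T (e ⊆ᵇ U) → ∣ U ─ e ∣ + ∣ e ∣ ≡ ∣ U ∣
∣─∣+∣∣≡∣∣ []          []          _ = refl
∣─∣+∣∣≡∣∣ (true  ∷ U) (false ∷ e) h = cong suc (∣─∣+∣∣≡∣∣ U e h)
∣─∣+∣∣≡∣∣ (false ∷ U) (false ∷ e) h = ∣─∣+∣∣≡∣∣ U e h
∣─∣+∣∣≡∣∣ (true  ∷ U) (true  ∷ e) h = trans (+-suc _ _) (cong suc (∣─∣+∣∣≡∣∣ U e h))

⊆ᵇ-⊤ : ∀ {m} (f : Subset m) → f ⊆ᵇ ⊤ ≡ true
⊆ᵇ-⊤ []          = refl
⊆ᵇ-⊤ (true  ∷ f) = ⊆ᵇ-⊤ f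
⊆ᵇ-⊤ (false ∷ f) = ⊆ᵇ-⊤ f

sumWhere-allSubsets : ∀ m P g → sumWhere (allSubsets (suc m)) P g ≡
  sumWhere (allSubsets m) (λ s → P (false ∷ s)) (λ s → g (false ∷ s)) +
  sumWhere (allSubsets m) (λ s → P (true ∷ s)) (λ s → g (true ∷ s))
sumWhere-allSubsets m P g =
  trans (sumWhere-++ (map (false ∷_) (allSubsets m)) (map (true ∷_) (allSubsets m)) P g)
        (cong₂ _+_ (sumWhere-map (false ∷_) (allSubsets m) P g)
                   (sumWhere-map (true ∷_) (allSubsets m) P g))

rSubsetᵇ : ∀ {m} → ℕ → Subset m → Subset m → Bool
rSubsetᵇ r U e = (∣ e ∣ ≡ᵇ r) ∧ (e ⊆ᵇ U)

rSubset-size : ∀ {m} r (U e : Subset m) → T (rSubsetᵇ r U e) → ∣ e ∣ ≡ r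
rSubset-size r U e h = ≡ᵇ⇒≡ ∣ e ∣ r (proj₁ (Equivalence.to (T-∧ {∣ e ∣ ≡ᵇ r} {e ⊆ᵇ U}) h))

rSubset-⊆ : ∀ {m} r (U e : Subset m) → T (rSubsetᵇ r U e) → T (e ⊆ᵇ U)
rSubset-⊆ r U e h = proj₂ (Equivalence.to (T-∧ {∣ e ∣ ≡ᵇ r} {e ⊆ᵇ U}) h)

∣─rSubset∣ : ∀ {m} r (U e : Subset m) → T (rSubsetᵇ r U e) → ∣ U ─ e ∣ ≡ ∣ U ∣ ∸ r
∣─rSubset∣ r U e h = begin
  ∣ U ─ e ∣                 ≡⟨ sym (m+n∸n≡m ∣ U ─ e ∣ r) ⟩
  ∣ U ─ e ∣ + r ∸ r         ≡⟨ cong (λ x → ∣ U ─ e ∣ + x ∸ r) (sym (rSubset-size r U e h)) ⟩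
  ∣ U ─ e ∣ + ∣ e ∣ ∸ r     ≡⟨ cong (_∸ r) (∣─∣+∣∣≡∣∣ U e (rSubset-⊆ r U e h)) ⟩
  ∣ U ∣ ∸ r                 ∎
  where open ≡-Reasoning

-- A set U has exactly C(∣ U ∣, r) subsets of size r (Pascal's rule on vertex 0).
number-of-rSubsets : ∀ {m} r (U : Subset m) →
                     sumWhere (allSubsets m) (rSubsetᵇ r U) (λ _ → 1) ≡ ∣ U ∣ C r
number-of-rSubsets {zero}  zero    []          = refl
number-of-rSubsets {zero}  (suc r) []          = refl
number-of-rSubsets {suc m} r       (false ∷ U) =
  trans (sumWhere-allSubsets m _ _)
        (trans (cong₂ _+_ (number-of-rSubsets r U)
                          (sumWhere-none (allSubsets m) _ _ (λ s → ∧-zeroʳ (suc ∣ s ∣ ≡ᵇ r))))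
               (+-identityʳ _))
number-of-rSubsets {suc m} zero    (true ∷ U)  =
  trans (sumWhere-allSubsets m _ _)
        (cong₂ _+_ (number-of-rSubsets zero U) (sumWhere-none (allSubsets m) _ _ (λ s → refl)))
number-of-rSubsets {suc m} (suc r) (true ∷ U)  =
  trans (sumWhere-allSubsets m _ _)
        (trans (cong₂ _+_ (number-of-rSubsets (suc r) U) (number-of-rSubsets r U))
               (trans (+-comm (∣ U ∣ C suc r) (∣ U ∣ C r)) (nCk+nC[k+1]≡[n+1]C[k+1] ∣ U ∣ r)))

C-positive : ∀ n k → k ≤ n → 0 < n C k
C-positive n       zero    _         = s≤s z≤n
C-positive (suc n) (suc k) (s≤s k≤n) =
  subst (0 <_) (nCk+nC[k+1]≡[n+1]C[k+1] n k) (≤-trans (C-positive n k k≤n) (m≤m+n _ _))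

countIn : ∀ {m} → ℕ → (Subset m → Bool) → Subset m → ℕ
countIn {m} r P U = sumWhere (allSubsets m) (λ f → rSubsetᵇ r U f ∧ P f) (λ _ → 1)

∧-shuffle : ∀ a b c d → (a ∧ (b ∧ c)) ∧ d ≡ ((a ∧ b) ∧ d) ∧ c
∧-shuffle true true  true  d = sym (∧-identityʳ d)
∧-shuffle true true  false d = sym (∧-zeroʳ d)
∧-shuffle true false c     d = refl
∧-shuffle false b    c     d = refl

-- An r-subset f ⊆ U lies in U ∖ e for exactly those
-- r-subsets e ⊆ U disjoint from f, and there are C(∣ U ∣ − r, r) of them.
sum-countIn-─ : ∀ {m} r P (U : Subset m) →
  sumWhere (allSubsets m) (rSubsetᵇ r U) (λ e → countIn r P (U ─ e)) ≡ countIn r P U * ((∣ U ∣ ∸ r) C r)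
sum-countIn-─ {m} r P U = begin
  sumWhere L (rSubsetᵇ r U) (λ e → countIn r P (U ─ e))
    ≡⟨ sumWhere-cong L (rSubsetᵇ r U) (λ e _ → countIn-─ e) ⟩
  sumWhere L (rSubsetᵇ r U) (λ e → sumWhere L RP (λ f → disjoint f e))
    ≡⟨ sumWhere-swap L L (rSubsetᵇ r U) RP (λ e f → disjoint f e) ⟩
  sumWhere L RP (λ f → sumWhere L (rSubsetᵇ r U) (disjoint f))
    ≡⟨ sumWhere-cong L RP (λ f h → disjoint-rSubsets f (proj₁ (Equivalence.to (T-∧ {rSubsetᵇ r U f} {P f}) h))) ⟩
  sumWhere L RP (λ _ → C′)
    ≡⟨ sumWhere-const L RP C′ ⟩
  C′ * countIn r P U
    ≡⟨ *-comm C′ _ ⟩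
  countIn r P U * C′ ∎
  where
  open ≡-Reasoning
  L  = allSubsets m
  RP = λ f → rSubsetᵇ r U f ∧ P f
  C′ = (∣ U ∣ ∸ r) C r

  disjoint : Subset m → Subset m → ℕ
  disjoint f e = if disjointᵇ f e then 1 else 0

  countIn-─ : ∀ e → countIn r P (U ─ e) ≡ sumWhere L RP (λ f → disjoint f e)
  countIn-─ e = trans
    (sumWhere-congᶠ L (λ _ → 1) λ f →
      trans (cong (λ z → ((∣ f ∣ ≡ᵇ r) ∧ z) ∧ P f) (⊆ᵇ-─ f U e))
            (∧-shuffle (∣ f ∣ ≡ᵇ r) (f ⊆ᵇ U) (disjointᵇ f e) (P f)))
    (sumWhere-∧ L RP (λ f → disjointᵇ f e) (λ _ → 1))

  disjoint-rSubsets : ∀ f → T (rSubsetᵇ r U f) → sumWhere L (rSubsetᵇ r U) (disjoint f) ≡ C′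
  disjoint-rSubsets f h = begin
    sumWhere L (rSubsetᵇ r U) (disjoint f)
      ≡⟨ sym (sumWhere-∧ L (rSubsetᵇ r U) (disjointᵇ f) (λ _ → 1)) ⟩
    sumWhere L (λ e → rSubsetᵇ r U e ∧ disjointᵇ f e) (λ _ → 1)
      ≡⟨ sumWhere-congᶠ L (λ _ → 1) (λ e →
           trans (cong (rSubsetᵇ r U e ∧_) (disjointᵇ-comm f e))
           (trans (∧-assoc (∣ e ∣ ≡ᵇ r) (e ⊆ᵇ U) (disjointᵇ e f))
                  (cong ((∣ e ∣ ≡ᵇ r) ∧_) (sym (⊆ᵇ-─ e U f))))) ⟩
    sumWhere L (rSubsetᵇ r (U ─ f)) (λ _ → 1)
      ≡⟨ number-of-rSubsets r (U ─ f) ⟩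
    ∣ U ─ f ∣ C r
      ≡⟨ cong (_C r) (∣─rSubset∣ r U f h) ⟩
    C′ ∎

T-∧-elim : ∀ x {y} → T (x ∧ y) → T x × T y
T-∧-elim x {y} = Equivalence.to (T-∧ {x} {y})

⊆ᵇ-─-elim : ∀ {m} (f U e : Subset m) → T (f ⊆ᵇ (U ─ e)) → T (f ⊆ᵇ U) × T (disjointᵇ f e)
⊆ᵇ-─-elim f U e h = T-∧-elim (f ⊆ᵇ U) (subst T (⊆ᵇ-─ f U e) h)

*-cancelʳ-≤-unless-zero : ∀ t x y c → (0 < t → 0 < c) → t * x * c ≤ y * c → t * x ≤ y
*-cancelʳ-≤-unless-zero zero    x y c _   _  = z≤n
*-cancelʳ-≤-unless-zero (suc t) x y c pos le =
  *-cancelʳ-≤ (suc t * x) y c {{>-nonZero (pos (s≤s z≤n))}} le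

module Averaging {r m : ℕ} (H : UniformHypergraph r m) where

  edge : Subset m → Bool
  edge = isEdge H

  edgesIn nonEdgesIn : Subset m → ℕ
  edgesIn    = countIn r edge
  nonEdgesIn = countIn r (λ f → not (edge f))

  edgesIn+nonEdgesIn : ∀ U → edgesIn U + nonEdgesIn U ≡ ∣ U ∣ C r
  edgesIn+nonEdgesIn U =
    trans (sym (sumWhere-split (allSubsets m) (rSubsetᵇ r U) edge (λ _ → 1))) (number-of-rSubsets r U)

  MatchingBoundIn : Subset m → ℕ → Set
  MatchingBoundIn U s = ∀ M → IsMatching H M → All (λ e → T (e ⊆ᵇ U)) M → length M ≤ s

  matchingBound-─ : ∀ {U s} e → MatchingBoundIn U s → MatchingBoundIn (U ─ e) s
  matchingBound-─ {U} e bound M isM inside =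
    bound M isM (All.map (λ {f} h → proj₁ (⊆ᵇ-─-elim f U e h)) inside)

  -- Removing an edge e ⊆ U lowers the bound by one: a matching inside U ∖ e
  -- extends by e to a matching inside U.
  matchingBound-─-edge : ∀ {U s} e → T (e ⊆ᵇ U) → T (edge e) →
                         MatchingBoundIn U (suc s) → MatchingBoundIn (U ─ e) s
  matchingBound-─-edge {U} e e⊆U e∈H bound M (edges , pairwise) inside =
    ≤-pred (bound (e ∷ M) (e∈H ∷ edges , All.map disjoint-e inside ∷ pairwise)
                  (e⊆U ∷ All.map (λ {f} h → proj₁ (⊆ᵇ-─-elim f U e h)) inside))
    where
    disjoint-e : ∀ {f} → T (f ⊆ᵇ (U ─ e)) → Disjoint e f
    disjoint-e {f} h =
      disjointᵇ⇒Disjoint e f (subst T (disjointᵇ-comm f e) (proj₂ (⊆ᵇ-─-elim f U e h)))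

  no-edgesIn : ∀ U → MatchingBoundIn U 0 → edgesIn U ≡ 0
  no-edgesIn U bound = sumWhere-none (allSubsets m) _ _ no-edge
    where
    no-edge : ∀ f → (rSubsetᵇ r U f ∧ edge f) ≡ false
    no-edge f with rSubsetᵇ r U f ∧ edge f in eq
    ... | false = refl
    ... | true  with T-∧-elim (rSubsetᵇ r U f) (subst T (sym eq) tt)
    ...   | f∈R , f∈H with bound (f ∷ []) (f∈H ∷ [] , [] ∷ []) (rSubset-⊆ r U f f∈R ∷ [])
    ...     | ()

  -- Induction on t: for each r-subset e ⊆ U apply the hypothesis to U ∖ e
  -- (with bound s − 1 if e is an edge, s otherwise) and sum over e, using the
  -- double-counting identity sum-countIn-─.
  averaging : ∀ t U s → r * t ≤ ∣ U ∣ → MatchingBoundIn U s → t * edgesIn U ≤ s * (∣ U ∣ C r)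
  averaging zero    U s       _    _     = z≤n
  averaging (suc t) U zero    _    bound =
    ≤-reflexive (trans (cong (suc t *_) (no-edgesIn U bound)) (*-zeroʳ (suc t)))
  averaging (suc t) U (suc s) rt≤U bound = begin
    a + t * a                 ≤⟨ +-monoʳ-≤ a (*-cancelʳ-≤-unless-zero t a _ C′ C′-positive summed) ⟩
    a + (s * a + suc s * b)   ≡⟨ solve 3 (λ a b s → a :+ (s :* a :+ (con 1 :+ s) :* b)
                                                        := (con 1 :+ s) :* (a :+ b)) refl a b s ⟩
    suc s * (a + b)           ≡⟨ cong (suc s *_) (edgesIn+nonEdgesIn U) ⟩
    suc s * (∣ U ∣ C r)       ∎
    where
    open ≤-Reasoning
    open +-*-Solver
    L  = allSubsets m
    R  = rSubsetᵇ r U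
    a  = edgesIn U
    b  = nonEdgesIn U
    C′ = (∣ U ∣ ∸ r) C r

    rt≤∣U∣∸r : r * t ≤ ∣ U ∣ ∸ r
    rt≤∣U∣∸r = subst (_≤ ∣ U ∣ ∸ r) (m+n∸m≡n r (r * t))
                 (∸-monoˡ-≤ r (subst (_≤ ∣ U ∣) (*-suc r t) rt≤U))

    C′-positive : 0 < t → 0 < C′
    C′-positive (s≤s _) = C-positive (∣ U ∣ ∸ r) r (≤-trans (m≤m*n r t) rt≤∣U∣∸r)

    removal : ∀ e s′ → T (R e) → MatchingBoundIn (U ─ e) s′ → t * edgesIn (U ─ e) ≤ s′ * C′
    removal e s′ e∈R bound′ =
      subst (λ x → t * edgesIn (U ─ e) ≤ s′ * (x C r)) (∣─rSubset∣ r U e e∈R)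
        (averaging t (U ─ e) s′ (subst (r * t ≤_) (sym (∣─rSubset∣ r U e e∈R)) rt≤∣U∣∸r) bound′)

    removal-edge : ∀ e → T (R e ∧ edge e) → t * edgesIn (U ─ e) ≤ s * C′
    removal-edge e h with T-∧-elim (R e) h
    ... | e∈R , e∈H = removal e s e∈R (matchingBound-─-edge e (rSubset-⊆ r U e e∈R) e∈H bound)

    removal-nonEdge : ∀ e → T (R e ∧ not (edge e)) → t * edgesIn (U ─ e) ≤ suc s * C′
    removal-nonEdge e h = removal e (suc s) (proj₁ (T-∧-elim (R e) h)) (matchingBound-─ e bound)

    summed : t * a * C′ ≤ (s * a + suc s * b) * C′
    summed = begin
      t * a * C′
        ≡⟨ *-assoc t a C′ ⟩
      t * (a * C′)
        ≡⟨ cong (t *_) (sym (sum-countIn-─ r edge U)) ⟩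
      t * sumWhere L R (λ e → edgesIn (U ─ e))
        ≡⟨ sym (sumWhere-*ˡ L R t (λ e → edgesIn (U ─ e))) ⟩
      sumWhere L R (λ e → t * edgesIn (U ─ e))
        ≡⟨ sumWhere-split L R edge _ ⟩
      sumWhere L (λ e → R e ∧ edge e) (λ e → t * edgesIn (U ─ e))
        + sumWhere L (λ e → R e ∧ not (edge e)) (λ e → t * edgesIn (U ─ e))
        ≤⟨ +-mono-≤ (sumWhere-mono L _ removal-edge) (sumWhere-mono L _ removal-nonEdge) ⟩
      sumWhere L (λ e → R e ∧ edge e) (λ _ → s * C′)
        + sumWhere L (λ e → R e ∧ not (edge e)) (λ _ → suc s * C′)
        ≡⟨ cong₂ _+_ (sumWhere-const L _ (s * C′)) (sumWhere-const L _ (suc s * C′)) ⟩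
      s * C′ * a + suc s * C′ * b
        ≡⟨ solve 4 (λ a b s c → s :* c :* a :+ (con 1 :+ s) :* c :* b
                                    := (s :* a :+ (con 1 :+ s) :* b) :* c) refl a b s C′ ⟩
      (s * a + suc s * b) * C′ ∎

  matchingBound-⊤ : ∀ n k .{{_ : NonZero k}} → MatchingNumberAtMost H n k → MatchingBoundIn ⊤ (n / k)
  matchingBound-⊤ n k bound M isM _ =
    subst (_≤ n / k) (m*n/n≡m (length M) k)
          (/-monoˡ-≤ k (subst (_≤ n) (*-comm k (length M)) (bound M isM)))

  nonEdgesIn-⊤ : nonEdgesIn ⊤ ≡ nonEdgeCount H
  nonEdgesIn-⊤ = trans
    (sumWhere-congᶠ (allSubsets m) (λ _ → 1) λ f →
      cong (λ z → z ∧ not (edge f))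
           (trans (cong ((∣ f ∣ ≡ᵇ r) ∧_) (⊆ᵇ-⊤ f)) (∧-identityʳ (∣ f ∣ ≡ᵇ r))))
    (sym (length-filterᵇ (allSubsets m) (λ f → (∣ f ∣ ≡ᵇ r) ∧ not (edge f))))

-- From t·a ≤ s·(a + b) and (k + 1)·s ≤ k·t with t > 0 it follows that
-- b is at least a (k + 1)-th of a + b: (k + 1)·t·a ≤ k·t·(a + b), so a ≤ k·b.
share-bound : ∀ k t s a b → 0 < t → (k + 1) * s ≤ k * t → t * a ≤ s * (a + b) →
              a + b ≤ (k + 1) * b
share-bound k t s a b t>0 [k+1]s≤kt ta≤s[a+b] = begin
  a + b        ≤⟨ +-monoˡ-≤ b a≤kb ⟩
  k * b + b    ≡⟨ solve 2 (λ k b → k :* b :+ b := (k :+ con 1) :* b) refl k b ⟩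
  (k + 1) * b  ∎
  where
  open ≤-Reasoning
  open +-*-Solver

  scaled : t * (k * a + a) ≤ t * (k * a + k * b)
  scaled = begin
    t * (k * a + a)      ≡⟨ solve 3 (λ t k a → t :* (k :* a :+ a) := (k :+ con 1) :* (t :* a)) refl t k a ⟩
    (k + 1) * (t * a)    ≤⟨ *-monoʳ-≤ (k + 1) ta≤s[a+b] ⟩
    (k + 1) * (s * (a + b)) ≡⟨ sym (*-assoc (k + 1) s (a + b)) ⟩
    (k + 1) * s * (a + b) ≤⟨ *-monoˡ-≤ (a + b) [k+1]s≤kt ⟩
    k * t * (a + b)      ≡⟨ solve 4 (λ t k a b → k :* t :* (a :+ b) := t :* (k :* a :+ k :* b)) refl t k a b ⟩
    t * (k * a + k * b)  ∎

  a≤kb : a ≤ k * b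
  a≤kb = +-cancelˡ-≤ (k * a) a (k * b) (*-cancelˡ-≤ t {{>-nonZero t>0}} scaled)

-- The parameters t = ⌊N/r⌋ (disjoint r-sets fitting into N vertices) and
-- s = ⌊n/k⌋ (the matching bound), where k = r + 1 and n = N + 1, satisfy
-- t > 0 and (k + 1)·s ≤ k·t as soon as r·k² ≤ n.  The key computation is
-- r·(k + 1) = k² − 1, so r(k + 1)·n ≤ k²·(n − r) ≤ k²·r·t.
parameters : ∀ r N .{{_ : NonZero r}} → r * (suc r * suc r) ≤ suc N →
             0 < N / r × (suc r + 1) * (suc N / suc r) ≤ suc r * (N / r)
parameters r N rk²≤n = m≥n⇒m/n>0 r≤N , *-cancelˡ-≤ (r * k) {{rk≢0}} scaled
  where
  open ≤-Reasoning
  open +-*-Solver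
  k = suc r
  n = suc N
  t = N / r
  s = n / k

  r≤N : r ≤ N
  r≤N = ≤-pred (<-≤-trans (m<m*n r (k * k) 1<k²) rk²≤n)
    where
    1<k² : 1 < k * k
    1<k² = ≤-trans (s≤s (>-nonZero⁻¹ r)) (m≤m*n k k)

  rk≢0 : NonZero (r * k)
  rk≢0 = >-nonZero (<-≤-trans (>-nonZero⁻¹ r) (m≤m*n r k))

  n≤rt+r : n ≤ r * t + r
  n≤rt+r = begin
    suc N              ≡⟨ cong suc (m≡m%n+[m/n]*n N r) ⟩
    suc (N % r + t * r) ≤⟨ +-monoˡ-≤ (t * r) (m%n<n N r) ⟩
    r + t * r          ≡⟨ solve 2 (λ r t → r :+ t :* r := r :* t :+ r) refl r t ⟩
    r * t + r          ∎

  -- r·(k + 1)·n + k²·r ≤ k²·r·t + k²·r, by r·(k + 1) + 1 = k² and k²·r ≤ n.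
  r[k+1]n≤k²rt : r * (k + 1) * n ≤ k * k * (r * t)
  r[k+1]n≤k²rt = +-cancelʳ-≤ (k * k * r) _ _ (begin
    r * (k + 1) * n + k * k * r   ≤⟨ +-monoʳ-≤ (r * (k + 1) * n) (≤-trans (≤-reflexive (*-comm (k * k) r)) rk²≤n) ⟩
    r * (k + 1) * n + n           ≡⟨ solve 2 (λ r n → r :* ((con 1 :+ r) :+ con 1) :* n :+ n
                                                  := (con 1 :+ r) :* (con 1 :+ r) :* n) refl r n ⟩
    k * k * n                     ≤⟨ *-monoʳ-≤ (k * k) n≤rt+r ⟩
    k * k * (r * t + r)           ≡⟨ *-distribˡ-+ (k * k) (r * t) r ⟩
    k * k * (r * t) + k * k * r   ∎)

  scaled : r * k * ((k + 1) * s) ≤ r * k * (k * t)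
  scaled = begin
    r * k * ((k + 1) * s)  ≡⟨ solve 3 (λ r k s → r :* k :* ((k :+ con 1) :* s) := r :* (k :+ con 1) :* (s :* k)) refl r k s ⟩
    r * (k + 1) * (s * k)  ≤⟨ *-monoʳ-≤ (r * (k + 1)) (m/n*n≤m n k) ⟩
    r * (k + 1) * n        ≤⟨ r[k+1]n≤k²rt ⟩
    k * k * (r * t)        ≡⟨ solve 3 (λ r k t → k :* k :* (r :* t) := r :* k :* (k :* t)) refl r k t ⟩
    r * k * (k * t)        ∎

cube-bound : ∀ r n → suc r ^ 3 < n → r * (suc r * suc r) ≤ n
cube-bound r n k³<n = begin
  r * (k * k)        ≤⟨ *-monoˡ-≤ (k * k) (n≤1+n r) ⟩
  k * (k * k)        ≡⟨ cong (λ x → k * (k * x)) (sym (*-identityʳ k)) ⟩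
  k ^ 3              ≤⟨ <⇒≤ k³<n ⟩
  n                  ∎
  where
  open ≤-Reasoning
  k = suc r

lemma2p2 : ∀ (k n : ℕ) → 2 ≤ k → k ^ 3 < n →
    (H : UniformHypergraph (k ∸ 1) (n ∸ 1)) →
    MatchingNumberAtMost H n k →
    (n ∸ 1) C (k ∸ 1) ≤ (k + 1) * nonEdgeCount H
lemma2p2 (suc (suc r₀)) zero    (s≤s (s≤s z≤n)) ()   H bound
lemma2p2 (suc (suc r₀)) (suc N) (s≤s (s≤s z≤n)) k³<n H bound = begin
  N C r                        ≡⟨ cong (_C r) (sym (∣⊤∣≡n N)) ⟩
  ∣ ⊤ {N} ∣ C r                ≡⟨ sym (edgesIn+nonEdgesIn ⊤) ⟩
  edgesIn ⊤ + nonEdgesIn ⊤     ≤⟨ share-bound k t s _ _ t>0 [k+1]s≤kt averaged ⟩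
  (k + 1) * nonEdgesIn ⊤       ≡⟨ cong ((k + 1) *_) nonEdgesIn-⊤ ⟩
  (k + 1) * nonEdgeCount H     ∎
  where
  open ≤-Reasoning
  open Averaging H
  r = suc r₀
  k = suc r
  t = N / r
  s = suc N / k

  t>0 : 0 < t
  t>0 = proj₁ (parameters r N (cube-bound r (suc N) k³<n))

  [k+1]s≤kt : (k + 1) * s ≤ k * t
  [k+1]s≤kt = proj₂ (parameters r N (cube-bound r (suc N) k³<n))

  rt≤N : r * t ≤ ∣ ⊤ {N} ∣
  rt≤N = subst (r * t ≤_) (sym (∣⊤∣≡n N)) (subst (_≤ N) (*-comm t r) (m/n*n≤m N r))

  averaged : t * edgesIn ⊤ ≤ s * (edgesIn ⊤ + nonEdgesIn ⊤)
  averaged = subst (λ x → t * edgesIn ⊤ ≤ s * x) (sym (edgesIn+nonEdgesIn ⊤))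
               (averaging t ⊤ s rt≤N (matchingBound-⊤ (suc N) k bound))
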